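{- Let $s \in \{ -1,1\}$. For each integer $t \geq 1$, write $t^2 - 4s = M(t)\, r(t)^2$ where $M(t)$ is the square-free part of $t^2-4s$ and $r(t) \geq 1$ (with $M(t)=0$ if $t^2-4s=0$). Let $t_0 \geq 1$ be such that $M := M(t_0) \geq 2$ and $M(t) \neq M$ for all integers $1 \leq t < t_0$. Then the unit $E_s(t_0) = \frac{1}{2}\big(t_0 + r(t_0)\sqrt{M}\big)$ is the fundamental unit of norm $s$ of $\mathbb{Q}(\sqrt M)$. More precisely, denoting by $\varepsilon_M$ the fundamental unit of $\mathbb{Q}(\sqrt M)$ and $\mathbf{S} = \mathbf{N}(\varepsilon_M)$: $E_s(t_0) = \varepsilon_M$ if $s = -1$ or if $s = \mathbf{S} = 1$, and $E_s(t_0) = \varepsilon_M^2$ if $s = 1$ and $\mathbf{S} = -1$.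
   Context: For a real quadratic field, $\varepsilon_M > 1$ denotes its fundamental unit and $\mathbf{N}$ the norm map to $\mathbb{Q}$. The fundamental unit of norm $s$ is the smallest unit $\eta > 1$ of the field with $\mathbf{N}(\eta) = s$. Note $E_s(t) = \frac12(t + \sqrt{t^2-4s})$ is a unit of norm $s$ and trace $t$. -}

module Defs where

open import Data.Nat as ℕ using (ℕ)
open import Data.Nat.Divisibility using (_∣_)
open import Data.Integer using (ℤ; +_; -_; _+_; _-_; _*_; _≤_; _<_; ∣_∣)
open import Data.Product using (_×_)
open import Data.Sum using (_⊎_)
open import Relation.Binary.PropositionalEquality using (_≡_; _≢_)
open import Relation.Nullary using (¬_)

SquareFree : ℤ → Set
SquareFree m = m ≢ + 0 × (∀ (d : ℕ) → (d ℕ.* d) ∣ ∣ m ∣ → d ≡ 1)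

SFDecomp : ℤ → ℤ → ℕ → Set
SFDecomp n M r =
  (n ≡ + 0 × M ≡ + 0)
  ⊎ (n ≢ + 0 × SquareFree M × 1 ℕ.≤ r × n ≡ M * (+ r * + r))

-- Elements of Q(√M) are represented as (x + y √M)/2 with x y : ℤ.
-- norm4 M x y = 4 · N((x + y√M)/2) = x² − M y².
norm4 : ℤ → ℤ → ℤ → ℤ
norm4 M x y = x * x - M * (y * y)

IsUnit : ℤ → ℤ → ℤ → Set
IsUnit M x y = norm4 M x y ≡ + 4 ⊎ norm4 M x y ≡ - + 4

-- Order on the real numbers a + b√M (M ≥ 2 not a square), expressed
-- exactly via integer arithmetic:  a + b√M > 0.
Pos : ℤ → ℤ → ℤ → Set
Pos M a b =
  (+ 0 ≤ a × + 0 ≤ b × ¬ (a ≡ + 0 × b ≡ + 0))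
  ⊎ (+ 0 ≤ a × b < + 0 × M * (b * b) < a * a)
  ⊎ (a < + 0 × + 0 < b × a * a < M * (b * b))

NonNeg : ℤ → ℤ → ℤ → Set
NonNeg M a b = (a ≡ + 0 × b ≡ + 0) ⊎ Pos M a b

-- (x + y√M)/2 > 1   ⟺   (x − 2) + y√M > 0
GtOne : ℤ → ℤ → ℤ → Set
GtOne M x y = Pos M (x - + 2) y

Le : ℤ → ℤ → ℤ → ℤ → ℤ → Set
Le M x y x' y' = NonNeg M (x' - x) (y' - y)

IsFundUnit : ℤ → ℤ → ℤ → Set
IsFundUnit M x y =
  IsUnit M x y × GtOne M x y
  × (∀ x' y' → IsUnit M x' y' → GtOne M x' y' → Le M x y x' y')

IsFundUnitOfNorm : ℤ → ℤ → ℤ → ℤ → Set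
IsFundUnitOfNorm M s x y =
  norm4 M x y ≡ + 4 * s × GtOne M x y
  × (∀ x' y' → norm4 M x' y' ≡ + 4 * s → GtOne M x' y' → Le M x y x' y')

-- (X + Y√M)/2 = ((x + y√M)/2)²  ⟺  2X = x² + M y²  and  Y = x y
IsSquareOf : ℤ → ℤ → ℤ → ℤ → ℤ → Set
IsSquareOf M X Y x y = + 2 * X ≡ x * x + M * (y * y) × Y ≡ x * y

-- A unit (w + z√M)/2 > 1 has w, z ≥ 1, and
-- w² − M z² = 4s holds exactly when M is the square-free part of w² − 4s; so the minimality of t₀
-- makes W = E_s(t₀) the least unit > 1 of norm s.  Compare W with the fundamental unit ε: if
-- N(ε) = s, both are least units of norm s and coincide.  Otherwise W/ε is a unit of norm −1 with
-- 1 < W/ε < W.  For s = −1 this contradicts the minimality of W; for s = 1 it gives ε ≤ W/ε, so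
-- ε² ≤ W, and since ε² has norm 1, W = ε².  That W/ε is again integral is a parity argument:
-- w ≡ M z (mod 2) for every solution of w² − M z² = ±4.

module Submission where

open import Data.Empty using (⊥; ⊥-elim)
open import Data.Product using (∃-syntax; _×_; _,_; proj₁; proj₂; map₂)
open import Data.Sign.Base as Sign using (Sign)
open import Data.Sum using (_⊎_; inj₁; inj₂)
open import Relation.Binary.PropositionalEquality
open import Defs

module PellSolutions where
  open import Data.List using (_∷_; [])
  open import Data.Nat
  open import Data.Nat.Properties
  open import Data.Nat.Tactic.RingSolver using (solve; solve-∀)
  open import Data.Parity.Base as ℙ using (0ℙ)
  import Data.Parity.Properties as ℙ

  data Pell : Sign → ℕ → ℕ → ℕ → Set where
    pell⁺ : ∀ {m w z} → w * w ≡ m * (z * z) + 4 → Pell Sign.+ m w z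
    pell⁻ : ∀ {m w z} → w * w + 4 ≡ m * (z * z) → Pell Sign.- m w z

  square-mono-≤ : ∀ {a b} → a ≤ b → a * a ≤ b * b
  square-mono-≤ a≤b = *-mono-≤ a≤b a≤b

  square-mono-< : ∀ {a b} → a < b → a * a < b * b
  square-mono-< a<b = *-mono-< a<b a<b

  square-cancel-≤ : ∀ {a b} → a * a ≤ b * b → a ≤ b
  square-cancel-≤ a²≤b² = ≮⇒≥ (λ b<a → <⇒≱ (square-mono-< b<a) a²≤b²)

  square-cancel-< : ∀ {a b} → a * a < b * b → a < b
  square-cancel-< a²<b² = ≰⇒> (λ b≤a → <⇒≱ a²<b² (square-mono-≤ b≤a))

  Pell-bounds : ∀ {σ m w z} → Pell σ m w z → w * w ≤ m * (z * z) + 4 × m * (z * z) ≤ w * w + 4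
  Pell-bounds (pell⁺ e) = ≤-reflexive e , ≤-trans (≤-trans (m≤m+n _ 4) (≤-reflexive (sym e))) (m≤m+n _ 4)
  Pell-bounds (pell⁻ e) = ≤-trans (≤-trans (m≤m+n _ 4) (≤-reflexive e)) (m≤m+n _ 4) , ≤-reflexive (sym e)

  Pell-cross : ∀ {σ m a b c d} → Pell σ m a b → Pell σ m c d → a * a + m * (d * d) ≡ c * c + m * (b * b)
  Pell-cross {m = m} {a} {b} {c} {d} (pell⁺ e₁) (pell⁺ e₂) = begin
    a * a + m * (d * d)           ≡⟨ cong (_+ m * (d * d)) e₁ ⟩
    m * (b * b) + 4 + m * (d * d) ≡⟨ solve (m ∷ b ∷ d ∷ []) ⟩
    m * (d * d) + 4 + m * (b * b) ≡⟨ cong (_+ m * (b * b)) e₂ ⟨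
    c * c + m * (b * b)           ∎
    where open ≡-Reasoning
  Pell-cross {m = m} {a} {b} {c} {d} (pell⁻ e₁) (pell⁻ e₂) = begin
    a * a + m * (d * d)   ≡⟨ cong (a * a +_) e₂ ⟨
    a * a + (c * c + 4)   ≡⟨ solve (a ∷ c ∷ []) ⟩
    c * c + (a * a + 4)   ≡⟨ cong (c * c +_) e₁ ⟩
    c * c + m * (b * b)   ∎
    where open ≡-Reasoning

  Pell-y<⇒x< : ∀ {σ m a b c d} .{{_ : NonZero m}} → Pell σ m a b → Pell σ m c d → d < b → c < a
  Pell-y<⇒x< {m = m} {a} {b} {c} {d} e₁ e₂ d<b =
    square-cancel-< (+-cancelʳ-< (m * (b * b)) (c * c) (a * a) (begin-strict
      c * c + m * (b * b) ≡⟨ Pell-cross e₁ e₂ ⟨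
      a * a + m * (d * d) <⟨ +-monoʳ-< (a * a) (*-monoʳ-< m (square-mono-< d<b)) ⟩
      a * a + m * (b * b) ∎))
    where open ≤-Reasoning

  Pell-x≤⇒y≤ : ∀ {σ m t r w z} .{{_ : NonZero m}} → Pell σ m t r → Pell σ m w z → t ≤ w → r ≤ z
  Pell-x≤⇒y≤ {m = m} {t} {r} {w} {z} e₁ e₂ t≤w =
    square-cancel-≤ (*-cancelˡ-≤ m (+-cancelˡ-≤ (t * t) _ _ (begin
      t * t + m * (r * r) ≤⟨ +-monoˡ-≤ (m * (r * r)) (square-mono-≤ t≤w) ⟩
      w * w + m * (r * r) ≡⟨ Pell-cross e₂ e₁ ⟩
      t * t + m * (z * z) ∎)))
    where open ≤-Reasoning

  Pell-y≡0⇒x≡2 : ∀ {σ m k} → Pell σ m (2 + k) 0 → k ≡ 0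
  Pell-y≡0⇒x≡2 {m = m} {k} e = n≤0⇒n≡0 (s≤s⁻¹ (s≤s⁻¹ (square-cancel-≤ {b = 2} (begin
    (2 + k) * (2 + k) ≤⟨ proj₁ (Pell-bounds e) ⟩
    m * 0 + 4         ≡⟨ cong (_+ 4) (*-zeroʳ m) ⟩
    4                 ∎))))
    where open ≤-Reasoning

  Pell-[x-2]²≤my² : ∀ {σ m k z} → Pell σ m (2 + k) z → k * k ≤ m * (z * z)
  Pell-[x-2]²≤my² {m = m} {k} {z} e = +-cancelʳ-≤ 4 _ _ (begin
    k * k + 4             ≤⟨ m≤m+n (k * k + 4) (4 * k) ⟩
    k * k + 4 + 4 * k     ≡⟨ solve (k ∷ []) ⟩
    (2 + k) * (2 + k)     ≤⟨ proj₁ (Pell-bounds e) ⟩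
    m * (z * z) + 4       ∎)
    where open ≤-Reasoning

  Pell-my²≤[x+2]² : ∀ {σ m w z} → Pell σ m w z → m * (z * z) ≤ (2 + w) * (2 + w)
  Pell-my²≤[x+2]² {m = m} {w} {z} e = begin
    m * (z * z)           ≤⟨ proj₂ (Pell-bounds e) ⟩
    w * w + 4             ≤⟨ m≤m+n (w * w + 4) (4 * w) ⟩
    w * w + 4 + 4 * w     ≡⟨ solve (w ∷ []) ⟩
    (2 + w) * (2 + w)     ∎
    where open ≤-Reasoning

  Pell⁺-x≥3 : ∀ {m w z} → 2 ≤ m → 1 ≤ z → Pell Sign.+ m w z → 3 ≤ w
  Pell⁺-x≥3 {m} {w} {z} m≥2 z≥1 (pell⁺ e) = ≮⇒≥ λ w<3 → <⇒≱ (begin-strict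
    w * w             ≤⟨ square-mono-≤ (s≤s⁻¹ w<3) ⟩
    4                 <⟨ m<n+m 4 (≤-trans (s≤s z≤n) (*-mono-≤ m≥2 (*-mono-≤ z≥1 z≥1))) ⟩
    m * (z * z) + 4   ≡⟨ e ⟨
    w * w             ∎) ≤-refl
    where open ≤-Reasoning

  even⇒half : ∀ n → parity n ≡ 0ℙ → ∃[ h ] h + h ≡ n
  even⇒half zero _ = 0 , refl
  even⇒half (suc zero) ()
  even⇒half (suc (suc n)) p with even⇒half n p
  ... | h , h+h≡n = suc h , cong suc (trans (+-suc h h) (cong suc h+h≡n))

  parity-square : ∀ n → parity (n * n) ≡ parity n
  parity-square n = trans (ℙ.*-homo-* n n) (ℙ.*-idem (parity n))

  parity-+4 : ∀ n → parity (n + 4) ≡ parity n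
  parity-+4 n = trans (ℙ.+-homo-+ n 4) (ℙ.+-identityʳ (parity n))

  Pell-parity : ∀ {σ m w z} → Pell σ m w z → parity w ≡ parity m ℙ.* parity z
  Pell-parity {m = m} {w} {z} e = begin
    parity w                    ≡⟨ parity-square w ⟨
    parity (w * w)              ≡⟨ parity-squares e ⟩
    parity (m * (z * z))        ≡⟨ ℙ.*-homo-* m (z * z) ⟩
    parity m ℙ.* parity (z * z) ≡⟨ cong (parity m ℙ.*_) (parity-square z) ⟩
    parity m ℙ.* parity z       ∎
    where
    open ≡-Reasoning
    parity-squares : ∀ {σ} → Pell σ m w z → parity (w * w) ≡ parity (m * (z * z))
    parity-squares (pell⁺ e) = trans (cong parity e) (parity-+4 (m * (z * z)))
    parity-squares (pell⁻ e) = trans (sym (parity-+4 (w * w))) (cong parity e)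

  equal-parity⇒even-sum : ∀ {x y} → parity x ≡ parity y → ∃[ h ] h + h ≡ x + y
  equal-parity⇒even-sum {x} {y} px≡py = even⇒half (x + y)
    (trans (ℙ.+-homo-+ x y) (trans (cong (parity x ℙ.+_) (sym px≡py)) (ℙ.p+p≡0ℙ (parity x))))

  -- Modulo 2 every solution has w ≡ m z, so (t + r√m)(a ∓ b√m) has even coordinates.
  conjugateProduct-even : ∀ {σ τ m t r a b} → Pell σ m t r → Pell τ m a b
    → (∃[ h ] h + h ≡ t * a + m * (r * b)) × (∃[ h ] h + h ≡ r * a + t * b)
  conjugateProduct-even {m = m} {t} {r} {a} {b} W E =
      equal-parity⇒even-sum {t * a} (begin
        parity (t * a)                ≡⟨ ℙ.*-homo-* t a ⟩
        parity t ℙ.* parity a         ≡⟨ cong₂ ℙ._*_ (Pell-parity W) (Pell-parity E) ⟩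
        (pm ℙ.* pr) ℙ.* (pm ℙ.* pb)   ≡⟨ idem-assoc pm pr pb ⟩
        pm ℙ.* (pr ℙ.* pb)            ≡⟨ cong (pm ℙ.*_) (ℙ.*-homo-* r b) ⟨
        pm ℙ.* parity (r * b)         ≡⟨ ℙ.*-homo-* m (r * b) ⟨
        parity (m * (r * b))          ∎)
    , equal-parity⇒even-sum {r * a} (begin
        parity (r * a)                ≡⟨ ℙ.*-homo-* r a ⟩
        pr ℙ.* parity a               ≡⟨ cong (pr ℙ.*_) (Pell-parity E) ⟩
        pr ℙ.* (pm ℙ.* pb)            ≡⟨ ℙ.*-assoc pr pm pb ⟨
        (pr ℙ.* pm) ℙ.* pb            ≡⟨ cong (ℙ._* pb) (ℙ.*-comm pr pm) ⟩
        (pm ℙ.* pr) ℙ.* pb            ≡⟨ cong (ℙ._* pb) (Pell-parity W) ⟨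
        parity t ℙ.* pb               ≡⟨ ℙ.*-homo-* t b ⟨
        parity (t * b)                ∎)
    where
    open ≡-Reasoning
    pm = parity m
    pr = parity r
    pb = parity b
    idem-assoc : ∀ p q s → (p ℙ.* q) ℙ.* (p ℙ.* s) ≡ p ℙ.* (q ℙ.* s)
    idem-assoc ℙ.0ℙ q s = refl
    idem-assoc ℙ.1ℙ q s = refl

  halve : ∀ {P Q} → Q < P → ∃[ h ] h + h ≡ P + Q → ∃[ p ] 1 ≤ p × p + p + Q ≡ P
  halve {P} {Q} Q<P (h , h+h≡P+Q) = h ∸ Q , m<n⇒0<n∸m Q<h , +-cancelʳ-≡ Q _ _ (begin
      h ∸ Q + (h ∸ Q) + Q + Q       ≡⟨ interleave (h ∸ Q) Q ⟩
      (h ∸ Q + Q) + (h ∸ Q + Q)     ≡⟨ cong₂ _+_ [h∸Q]+Q≡h [h∸Q]+Q≡h ⟩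
      h + h                         ≡⟨ h+h≡P+Q ⟩
      P + Q                         ∎)
    where
    open ≡-Reasoning
    Q<h : Q < h
    Q<h = ≰⇒> λ h≤Q → <⇒≱ (+-monoˡ-< Q Q<P) (subst (_≤ Q + Q) h+h≡P+Q (+-mono-≤ h≤Q h≤Q))
    [h∸Q]+Q≡h : h ∸ Q + Q ≡ h
    [h∸Q]+Q≡h = m∸n+n≡m (<⇒≤ Q<h)
    interleave : ∀ x y → x + x + y + y ≡ (x + y) + (x + y)
    interleave = solve-∀

  <⇒square+4< : ∀ {a t} → 3 ≤ t → a < t → a * a + 4 < t * t
  <⇒square+4< {a} {t} (s≤s (s≤s (s≤s (z≤n {k})))) a<t = begin-strict
    a * a + 4                                 ≤⟨ +-monoˡ-≤ 4 (square-mono-≤ (s≤s⁻¹ a<t)) ⟩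
    (2 + k) * (2 + k) + 4                     <⟨ m<m+n _ (s≤s z≤n) ⟩
    (2 + k) * (2 + k) + 4 + (1 + 2 * k)       ≡⟨ solve (k ∷ []) ⟩
    (3 + k) * (3 + k)                         ∎
    where open ≤-Reasoning

  -- The coordinates of W ε̄ for W = (t + r√m)/2 of norm −1 and ε = (a + b√m)/2 of norm 1 are
  -- positive when ε ≤ W, which the hypothesis a ≤ t ⊎ b < r expresses.
  conjugateProduct-positive⁻ : ∀ {m t r a b} → 2 ≤ m → 1 ≤ b → Pell Sign.- m t r → Pell Sign.+ m a b
    → a ≤ t ⊎ b < r → m * (r * b) < t * a × t * b < r * a
  conjugateProduct-positive⁻ {m} {t} {r} {a} {b} m≥2 b≥1 (pell⁻ W) (pell⁺ E) a≤t⊎b<r =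
    x-positive , y-positive
    where
    open ≤-Reasoning
    a²<t²+4 : a ≤ t ⊎ b < r → a * a < t * t + 4
    a²<t²+4 (inj₁ a≤t) = ≤-<-trans (square-mono-≤ a≤t) (m<m+n _ (s≤s z≤n))
    a²<t²+4 (inj₂ b<r) = begin-strict
      a * a                             ≡⟨ E ⟩
      m * (b * b) + 4                   <⟨ +-monoʳ-< (m * (b * b))
                                             (≤-trans (n≤1+n 5) (*-mono-≤ m≥2 (+-monoˡ-≤ 1 (*-monoʳ-≤ 2 b≥1)))) ⟩
      m * (b * b) + m * (2 * b + 1)     ≡⟨ solve (m ∷ b ∷ []) ⟩
      m * ((1 + b) * (1 + b))           ≤⟨ *-monoʳ-≤ m (square-mono-≤ b<r) ⟩
      m * (r * r)                       ≡⟨ W ⟨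
      t * t + 4                         ∎
    x-positive : m * (r * b) < t * a
    x-positive = square-cancel-< (+-cancelʳ-< (4 * (t * t) + 16) _ _ (begin-strict
      m * (r * b) * (m * (r * b)) + (4 * (t * t) + 16) ≡⟨ solve (m ∷ r ∷ b ∷ t ∷ []) ⟩
      m * (r * r) * (m * (b * b)) + 4 * (t * t + 4)     ≡⟨ cong (λ u → u * (m * (b * b)) + 4 * (t * t + 4)) W ⟨
      (t * t + 4) * (m * (b * b)) + 4 * (t * t + 4)     ≡⟨ solve (t ∷ m ∷ b ∷ []) ⟩
      (t * t + 4) * (m * (b * b) + 4)                   ≡⟨ cong ((t * t + 4) *_) E ⟨
      (t * t + 4) * (a * a)                             ≡⟨ solve (t ∷ a ∷ []) ⟩
      t * a * (t * a) + 4 * (a * a)                     <⟨ +-monoʳ-< (t * a * (t * a)) (*-monoʳ-< 4 (a²<t²+4 a≤t⊎b<r)) ⟩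
      t * a * (t * a) + 4 * (t * t + 4)                 ≡⟨ solve (t ∷ a ∷ []) ⟩
      t * a * (t * a) + (4 * (t * t) + 16)              ∎))
    y-positive : t * b < r * a
    y-positive = square-cancel-< (*-cancelˡ-< m _ _ (begin-strict
      m * (t * b * (t * b))               ≤⟨ m≤m+n _ (4 * (t * t)) ⟩
      m * (t * b * (t * b)) + 4 * (t * t) ≡⟨ solve (m ∷ t ∷ b ∷ []) ⟩
      t * t * (m * (b * b) + 4)           ≡⟨ cong (t * t *_) E ⟨
      t * t * (a * a)                     <⟨ m<m+n _ (*-monoʳ-< 4 (<-≤-trans (s≤s z≤n) (≤-trans (m≤n+m 4 _)
                                                                                         (≤-reflexive (sym E))))) ⟩
      t * t * (a * a) + 4 * (a * a)       ≡⟨ solve (t ∷ a ∷ []) ⟩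
      (t * t + 4) * (a * a)               ≡⟨ cong (_* (a * a)) W ⟩
      m * (r * r) * (a * a)               ≡⟨ solve (m ∷ r ∷ a ∷ []) ⟩
      m * (r * a * (r * a))               ∎))

  conjugateProduct-positive⁺ : ∀ {m t r a b} → 2 ≤ m → 1 ≤ r → Pell Sign.+ m t r → Pell Sign.- m a b
    → b ≤ r ⊎ a < t → t * a < m * (r * b) × r * a < t * b
  conjugateProduct-positive⁺ {m} {t} {r} {a} {b} m≥2 r≥1 W@(pell⁺ W≡) (pell⁻ E) b≤r⊎a<t =
    x-positive , y-positive
    where
    open ≤-Reasoning
    mb²<t² : b ≤ r ⊎ a < t → m * (b * b) < t * t
    mb²<t² (inj₁ b≤r) =
      ≤-<-trans (*-monoʳ-≤ m (square-mono-≤ b≤r)) (subst (m * (r * r) <_) (sym W≡) (m<m+n _ (s≤s z≤n)))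
    mb²<t² (inj₂ a<t) = subst (_< t * t) E (<⇒square+4< (Pell⁺-x≥3 m≥2 r≥1 W) a<t)
    x-positive : t * a < m * (r * b)
    x-positive = square-cancel-< (+-cancelʳ-< (4 * (t * t)) _ _ (begin-strict
      t * a * (t * a) + 4 * (t * t)                     ≡⟨ solve (t ∷ a ∷ []) ⟩
      t * t * (a * a + 4)                               ≡⟨ cong (t * t *_) E ⟩
      t * t * (m * (b * b))                             ≡⟨ cong (_* (m * (b * b))) W≡ ⟩
      (m * (r * r) + 4) * (m * (b * b))                 ≡⟨ solve (m ∷ r ∷ b ∷ []) ⟩
      m * (r * b) * (m * (r * b)) + 4 * (m * (b * b))   <⟨ +-monoʳ-< (m * (r * b) * (m * (r * b)))
                                                            (*-monoʳ-< 4 (mb²<t² b≤r⊎a<t)) ⟩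
      m * (r * b) * (m * (r * b)) + 4 * (t * t)         ∎))
    y-positive : r * a < t * b
    y-positive = square-cancel-< (*-cancelˡ-< m _ _ (begin-strict
      m * (r * a * (r * a))               ≤⟨ m≤m+n _ (4 * (a * a)) ⟩
      m * (r * a * (r * a)) + 4 * (a * a) ≡⟨ solve (m ∷ r ∷ a ∷ []) ⟩
      (m * (r * r) + 4) * (a * a)         ≡⟨ cong (_* (a * a)) W≡ ⟨
      t * t * (a * a)                     <⟨ m<m+n _ (*-monoʳ-< 4 (<-≤-trans (s≤s z≤n) (≤-trans (m≤n+m 4 _)
                                                                                         (≤-reflexive (sym W≡))))) ⟩
      t * t * (a * a) + 4 * (t * t)       ≡⟨ solve (t ∷ a ∷ []) ⟩
      t * t * (a * a + 4)                 ≡⟨ cong (t * t *_) E ⟩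
      t * t * (m * (b * b))               ≡⟨ solve (t ∷ m ∷ b ∷ []) ⟩
      m * (t * b * (t * b))               ∎))

  -- Product m p q a b t r : (p + q√m)/2 · (a + b√m)/2 = (t + r√m)/2
  Product : ℕ → ℕ → ℕ → ℕ → ℕ → ℕ → ℕ → Set
  Product m p q a b t r = p * a + m * (q * b) ≡ 2 * t × q * a + p * b ≡ 2 * r

  factor-x<product-x : ∀ {m p q a b t r} → 3 ≤ a → 1 ≤ t → Product m p q a b t r → p < t
  factor-x<product-x {m} {p} {q} {a} {b} {t} a≥3 t≥1 (e , _) = *-cancelˡ-< 3 p t (begin-strict
    3 * p                   ≤⟨ ≤-reflexive (*-comm 3 p) ⟩
    p * 3                   ≤⟨ *-monoʳ-≤ p a≥3 ⟩
    p * a                   ≤⟨ m≤m+n (p * a) (m * (q * b)) ⟩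
    p * a + m * (q * b)     ≡⟨ e ⟩
    2 * t                   <⟨ m<n+m (2 * t) t≥1 ⟩
    3 * t                   ∎)
    where open ≤-Reasoning

  Pell⁻-square : ∀ {m a b} → Pell Sign.- m a b → Pell Sign.+ m (a * a + 2) (a * b)
  Pell⁻-square {m} {a} {b} (pell⁻ E) = pell⁺ (begin
    (a * a + 2) * (a * a + 2)   ≡⟨ solve (a ∷ []) ⟩
    a * a * (a * a + 4) + 4     ≡⟨ cong (λ u → a * a * u + 4) E ⟩
    a * a * (m * (b * b)) + 4   ≡⟨ solve (a ∷ m ∷ b ∷ []) ⟩
    m * (a * b * (a * b)) + 4   ∎)
    where open ≡-Reasoning

  Pell⁻⇒2[a²+2]≡a²+mb² : ∀ {m a b} → Pell Sign.- m a b → 2 * (a * a + 2) ≡ a * a + m * (b * b)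
  Pell⁻⇒2[a²+2]≡a²+mb² {m} {a} {b} (pell⁻ E) = begin
    2 * (a * a + 2)       ≡⟨ solve (a ∷ []) ⟩
    a * a + (a * a + 4)   ≡⟨ cong (a * a +_) E ⟩
    a * a + m * (b * b)   ∎
    where open ≡-Reasoning

  square≤product : ∀ {m p q a b t r} → Pell Sign.- m a b → a ≤ p → b ≤ q → Product m p q a b t r
    → a * a + 2 ≤ t × a * b ≤ r
  square≤product {m} {p} {q} {a} {b} {t} {r} E a≤p b≤q (x≡ , y≡) =
      *-cancelˡ-≤ 2 (begin
        2 * (a * a + 2)         ≡⟨ Pell⁻⇒2[a²+2]≡a²+mb² E ⟩
        a * a + m * (b * b)     ≤⟨ +-mono-≤ (*-monoˡ-≤ a a≤p) (*-monoʳ-≤ m (*-monoˡ-≤ b b≤q)) ⟩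
        p * a + m * (q * b)     ≡⟨ x≡ ⟩
        2 * t                   ∎)
    , *-cancelˡ-≤ 2 (begin
        2 * (a * b)             ≡⟨ solve (a ∷ b ∷ []) ⟩
        b * a + a * b           ≤⟨ +-mono-≤ (*-monoˡ-≤ a b≤q) (*-monoˡ-≤ b a≤p) ⟩
        q * a + p * b           ≡⟨ y≡ ⟩
        2 * r                   ∎)
    where open ≤-Reasoning

module IntegerEncoding where
  open import Data.Nat as ℕ using (ℕ; zero; suc; z≤n; s≤s; NonZero)
  import Data.Nat.Properties as ℕₚ
  open import Data.Integer.Base using (ℤ; +_; -_; -[1+_]; ∣_∣; _+_; _-_; _*_; _<_; _◃_; +≤+; +<+; -<+)
  open import Data.Integer.Properties
    using ( pos-*; +-injective; *-comm; *-cancelˡ-≡; m-n≡m⊖n; ⊖-≥; ⊖-<; neg-mono-<; drop‿+<+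
          ; <⇒≱; <-irrefl; <-asym)
  open import Data.Integer.Tactic.RingSolver using (solve-∀)
  open import Relation.Nullary using (contradiction)
  open PellSolutions

  ∣∣-square : ∀ i → i * i ≡ + (∣ i ∣ ℕ.* ∣ i ∣)
  ∣∣-square (+ n)    = sym (pos-* n n)
  ∣∣-square -[1+ n ] = refl

  scaled-∣∣-square : ∀ m i → + m * (i * i) ≡ + (m ℕ.* (∣ i ∣ ℕ.* ∣ i ∣))
  scaled-∣∣-square m i = trans (cong (+ m *_) (∣∣-square i)) (sym (pos-* m _))

  pos-*-* : ∀ m r b → + (m ℕ.* (r ℕ.* b)) ≡ + m * (+ r * + b)
  pos-*-* m r b = trans (pos-* m _) (cong (+ m *_) (pos-* r b))

  norm4-∣∣ : ∀ m x y → norm4 (+ m) x y ≡ + (∣ x ∣ ℕ.* ∣ x ∣) - + (m ℕ.* (∣ y ∣ ℕ.* ∣ y ∣))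
  norm4-∣∣ m x y = cong₂ _-_ (∣∣-square x) (scaled-∣∣-square m y)

  x-[x-y]≡y : ∀ x y → x - (x - y) ≡ y
  x-[x-y]≡y = solve-∀

  +a-+b≡+k⇒a≡b+k : ∀ {a b k} → + a - + b ≡ + k → a ≡ b ℕ.+ k
  +a-+b≡+k⇒a≡b+k {a} {b} h = +-injective (trans (x≡y+[x-y] (+ a) (+ b)) (cong (_+_ (+ b)) h))
    where
    x≡y+[x-y] : ∀ x y → x ≡ y + (x - y)
    x≡y+[x-y] = solve-∀

  a≡b+k⇒+a-+b≡+k : ∀ {a b k} → a ≡ b ℕ.+ k → + a - + b ≡ + k
  a≡b+k⇒+a-+b≡+k {b = b} {k} refl = [x+y]-x≡y (+ b) (+ k)
    where
    [x+y]-x≡y : ∀ x y → (x + y) - x ≡ y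
    [x+y]-x≡y = solve-∀

  +a-+b≡-k⇒a+k≡b : ∀ {a b k} → + a - + b ≡ - + k → a ℕ.+ k ≡ b
  +a-+b≡-k⇒a+k≡b {a} {b} {k} h = +-injective (begin
    + a + + k            ≡⟨ x+y≡x-[-y] (+ a) (+ k) ⟩
    + a - (- + k)        ≡⟨ cong (λ u → + a - u) h ⟨
    + a - (+ a - + b)    ≡⟨ x-[x-y]≡y (+ a) (+ b) ⟩
    + b                  ∎)
    where
    open ≡-Reasoning
    x+y≡x-[-y] : ∀ x y → x + y ≡ x - (- y)
    x+y≡x-[-y] = solve-∀

  a+k≡b⇒+a-+b≡-k : ∀ {a b k} → a ℕ.+ k ≡ b → + a - + b ≡ - + k
  a+k≡b⇒+a-+b≡-k {a} {k = k} refl = x-[x+y]≡-y (+ a) (+ k)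
    where
    x-[x+y]≡-y : ∀ x y → x - (x + y) ≡ - y
    x-[x+y]≡-y = solve-∀

  norm4≡⇒Pell : ∀ σ m x y → norm4 (+ m) x y ≡ + 4 * (σ ◃ 1) → Pell σ m ∣ x ∣ ∣ y ∣
  norm4≡⇒Pell Sign.+ m x y N≡ = pell⁺ (+a-+b≡+k⇒a≡b+k (trans (sym (norm4-∣∣ m x y)) N≡))
  norm4≡⇒Pell Sign.- m x y N≡ = pell⁻ (+a-+b≡-k⇒a+k≡b (trans (sym (norm4-∣∣ m x y)) N≡))

  Pell⇒norm4≡ : ∀ {σ m w z} → Pell σ m w z → norm4 (+ m) (+ w) (+ z) ≡ + 4 * (σ ◃ 1)
  Pell⇒norm4≡ {m = m} {w} {z} (pell⁺ e) = trans (norm4-∣∣ m (+ w) (+ z)) (a≡b+k⇒+a-+b≡+k e)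
  Pell⇒norm4≡ {m = m} {w} {z} (pell⁻ e) = trans (norm4-∣∣ m (+ w) (+ z)) (a+k≡b⇒+a-+b≡-k e)

  decomposition⇒Pell : ∀ σ {m t r} → + t * + t - + 4 * (σ ◃ 1) ≡ + m * (+ r * + r) → Pell σ m t r
  decomposition⇒Pell σ {m} {t} {r} eq = norm4≡⇒Pell σ m (+ t) (+ r)
    (trans (cong (λ u → + t * + t - u) (sym eq)) (x-[x-y]≡y (+ t * + t) (+ 4 * (σ ◃ 1))))

  Pell⇒decomposition : ∀ {σ m t r} → Pell σ m t r → + t * + t - + 4 * (σ ◃ 1) ≡ + m * (+ r * + r)
  Pell⇒decomposition {m = m} {t} {r} e =
    trans (cong (λ u → + t * + t - u) (sym (Pell⇒norm4≡ e))) (x-[x-y]≡y (+ t * + t) (+ m * (+ r * + r)))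

  +c-+a≡+[c∸a] : ∀ {a c} → a ℕ.≤ c → + c - + a ≡ + (c ℕ.∸ a)
  +c-+a≡+[c∸a] {a} {c} a≤c = trans (m-n≡m⊖n c a) (⊖-≥ a≤c)

  +c-+a<0 : ∀ {a c} → c ℕ.< a → + c - + a < + 0
  +c-+a<0 {a} {c} c<a =
    subst (_< + 0) (sym (trans (m-n≡m⊖n c a) (⊖-< c<a))) (neg-mono-< (+<+ (ℕₚ.m<n⇒0<n∸m c<a)))

  NonNeg-pos : ∀ m i j → NonNeg (+ m) (+ i) (+ j)
  NonNeg-pos m zero    zero    = inj₁ (refl , refl)
  NonNeg-pos m (suc i) j       = inj₂ (inj₁ (+≤+ z≤n , +≤+ z≤n , λ { (() , _) }))
  NonNeg-pos m zero    (suc j) = inj₂ (inj₁ (+≤+ z≤n , +≤+ z≤n , λ { (_ , ()) }))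

  NonNeg-x<0⇒y>0 : ∀ {M x y} → NonNeg M x y → x < + 0 → + 0 < y
  NonNeg-x<0⇒y>0 (inj₁ (refl , _))                  x<0 = contradiction x<0 (<-irrefl refl)
  NonNeg-x<0⇒y>0 (inj₂ (inj₁ (0≤x , _)))            x<0 = contradiction 0≤x (<⇒≱ x<0)
  NonNeg-x<0⇒y>0 (inj₂ (inj₂ (inj₁ (0≤x , _))))     x<0 = contradiction 0≤x (<⇒≱ x<0)
  NonNeg-x<0⇒y>0 (inj₂ (inj₂ (inj₂ (_ , 0<y , _)))) _   = 0<y

  NonNeg-y<0⇒My²<x² : ∀ {M x y} → NonNeg M x y → y < + 0 → M * (y * y) < x * x
  NonNeg-y<0⇒My²<x² (inj₁ (_ , refl))                  y<0 = contradiction y<0 (<-irrefl refl)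
  NonNeg-y<0⇒My²<x² (inj₂ (inj₁ (_ , 0≤y , _)))        y<0 = contradiction 0≤y (<⇒≱ y<0)
  NonNeg-y<0⇒My²<x² (inj₂ (inj₂ (inj₁ (_ , _ , lt))))  _   = lt
  NonNeg-y<0⇒My²<x² (inj₂ (inj₂ (inj₂ (_ , 0<y , _)))) y<0 = contradiction y<0 (<-asym 0<y)

  ≤×≤⇒Le : ∀ m {a b c d} → a ℕ.≤ c → b ℕ.≤ d → Le (+ m) (+ a) (+ b) (+ c) (+ d)
  ≤×≤⇒Le m a≤c b≤d =
    subst₂ (NonNeg (+ m)) (sym (+c-+a≡+[c∸a] a≤c)) (sym (+c-+a≡+[c∸a] b≤d)) (NonNeg-pos m _ _)

  Le-cases : ∀ m {a b c d} → Le (+ m) (+ a) (+ b) (+ c) (+ d)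
    → (a ℕ.≤ c × b ℕ.≤ d) ⊎ (a ℕ.< c × d ℕ.< b) ⊎ (c ℕ.< a × b ℕ.< d)
  Le-cases m {a} {b} {c} {d} le with ℕₚ.≤-<-connex a c | ℕₚ.≤-<-connex b d
  ... | inj₁ a≤c | inj₁ b≤d = inj₁ (a≤c , b≤d)
  ... | inj₁ a≤c | inj₂ d<b = inj₂ (inj₁ (ℕₚ.m∸n≢0⇒n<m c∸a≢0 , d<b))
    where
    c∸a≢0 : c ℕ.∸ a ≢ 0
    c∸a≢0 c∸a≡0 = ℕₚ.<⇒≱ (drop‿+<+ (subst₂ _<_ (scaled-∣∣-square m (+ d - + b)) x²≡0 My²<x²)) z≤n
      where
      My²<x² = NonNeg-y<0⇒My²<x² {+ m} le (+c-+a<0 d<b)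
      x²≡0 : (+ c - + a) * (+ c - + a) ≡ + 0
      x²≡0 = cong (λ x → x * x) (trans (+c-+a≡+[c∸a] a≤c) (cong +_ c∸a≡0))
  ... | inj₂ c<a | inj₁ b≤d = inj₂ (inj₂ (c<a , ℕₚ.m∸n≢0⇒n<m (ℕₚ.>⇒≢ (drop‿+<+ 0<d∸b))))
    where
    0<d∸b : + 0 < + (d ℕ.∸ b)
    0<d∸b = subst (+ 0 <_) (+c-+a≡+[c∸a] b≤d) (NonNeg-x<0⇒y>0 {+ m} le (+c-+a<0 c<a))
  ... | inj₂ c<a | inj₂ d<b = contradiction (NonNeg-x<0⇒y>0 {+ m} le (+c-+a<0 c<a)) (<-asym (+c-+a<0 d<b))

  Pell-Le⇒≤×≤ : ∀ {σ m a b c d} .{{_ : NonZero m}} → Pell σ m a b → Pell σ m c d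
    → Le (+ m) (+ a) (+ b) (+ c) (+ d) → a ℕ.≤ c × b ℕ.≤ d
  Pell-Le⇒≤×≤ {m = m} e₁ e₂ le with Le-cases m le
  ... | inj₁ ≤×≤                 = ≤×≤
  ... | inj₂ (inj₁ (a<c , d<b)) = contradiction (Pell-y<⇒x< e₁ e₂ d<b) (ℕₚ.<-asym a<c)
  ... | inj₂ (inj₂ (c<a , b<d)) = contradiction (Pell-y<⇒x< e₂ e₁ b<d) (ℕₚ.<-asym c<a)

  positive⇒GtOne : ∀ {m w z} → 2 ℕ.≤ m → 1 ℕ.≤ w → 1 ℕ.≤ z → GtOne (+ m) (+ w) (+ z)
  positive⇒GtOne {w = suc (suc k)} {suc z} _ _ _ = inj₁ (+≤+ z≤n , +≤+ z≤n , λ { (_ , ()) })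
  positive⇒GtOne {m} {suc zero} {suc z} m≥2 _ _ = inj₂ (inj₂ (-<+ , +<+ (s≤s z≤n) ,
    subst (+ 1 <_) (sym (scaled-∣∣-square m (+ suc z))) (+<+ (ℕₚ.*-mono-≤ m≥2 (s≤s z≤n)))))

  PositiveSolution : Sign → ℕ → ℤ → ℤ → Set
  PositiveSolution σ m x y = ∃[ w ] ∃[ z ] x ≡ + w × y ≡ + z × 1 ℕ.≤ w × 1 ℕ.≤ z × Pell σ m w z

  GtOne⇒positive : ∀ σ {m} x y → norm4 (+ m) x y ≡ + 4 * (σ ◃ 1) → GtOne (+ m) x y
    → PositiveSolution σ m x y
  GtOne⇒positive σ {m} x y N≡ x>1 = classify x y (norm4≡⇒Pell σ m x y N≡) x>1
    where
    classify : ∀ x y → Pell σ m ∣ x ∣ ∣ y ∣ → Pos (+ m) (x - + 2) y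
      → PositiveSolution σ m x y
    classify (+ suc (suc k)) (+ zero) e (inj₁ (_ , _ , ¬x-2≡0×y≡0)) =
      contradiction (cong +_ (Pell-y≡0⇒x≡2 e) , refl) ¬x-2≡0×y≡0
    classify (+ suc (suc k)) (+ suc z) e (inj₁ _) = suc (suc k) , suc z , refl , refl , s≤s z≤n , s≤s z≤n , e
    classify (+ zero)        y          e (inj₁ (() , _))
    classify (+ suc zero)    y          e (inj₁ (() , _))
    classify -[1+ n ]        y          e (inj₁ (() , _))
    classify (+ suc (suc k)) -[1+ j ]   e (inj₁ (_ , () , _))
    classify (+ suc (suc k)) -[1+ j ]   e (inj₂ (inj₁ (_ , _ , my²<[x-2]²))) =
      contradiction (Pell-[x-2]²≤my² e)
        (ℕₚ.<⇒≱ (drop‿+<+ (subst₂ _<_ (scaled-∣∣-square m -[1+ j ]) (sym (pos-* k k)) my²<[x-2]²)))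
    classify (+ zero)        y          e (inj₂ (inj₁ (() , _)))
    classify (+ suc zero)    y          e (inj₂ (inj₁ (() , _)))
    classify -[1+ n ]        y          e (inj₂ (inj₁ (() , _)))
    classify (+ suc (suc k)) (+ j)      e (inj₂ (inj₁ (_ , +<+ () , _)))
    classify x               (+ zero)   e (inj₂ (inj₂ (_ , +<+ () , _)))
    classify x               -[1+ j ]   e (inj₂ (inj₂ (_ , () , _)))
    classify (+ suc (suc k)) (+ suc z)  e (inj₂ (inj₂ (+<+ () , _)))
    classify (+ suc zero)    (+ suc z)  e (inj₂ (inj₂ _)) = 1 , suc z , refl , refl , s≤s z≤n , s≤s z≤n , e
    classify (+ zero)        (+ suc z)  e (inj₂ (inj₂ (_ , _ , [x-2]²<my²))) =
      contradiction (Pell-my²≤[x+2]² e)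
        (ℕₚ.<⇒≱ (drop‿+<+ (subst (+ 4 <_) (scaled-∣∣-square m (+ suc z)) [x-2]²<my²)))
    classify -[1+ n ]        (+ suc z)  e (inj₂ (inj₂ (_ , _ , [x-2]²<my²))) =
      contradiction (Pell-my²≤[x+2]² e) (ℕₚ.<⇒≱ (subst (λ k → suc (suc k) ℕ.* suc (suc k) ℕ.< my²) (ℕₚ.+-comm n 1)
        (drop‿+<+ (subst₂ _<_ (∣∣-square (-[1+ n ] - + 2)) (scaled-∣∣-square m (+ suc z)) [x-2]²<my²))))
      where my² = m ℕ.* (suc z ℕ.* suc z)

  isolate : ∀ {a b c} → a + b ≡ c → a ≡ c - b
  isolate {a} {b} refl = x≡[x+y]-y a b
    where
    x≡[x+y]-y : ∀ x y → x ≡ (x + y) - y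
    x≡[x+y]-y = solve-∀

  conjugateProduct⁻ : ∀ {M T R X Y A B} → norm4 M T R ≡ - + 4 → norm4 M X Y ≡ + 4
    → A + M * (R * Y) ≡ T * X → B + T * Y ≡ R * X
    → norm4 M A B ≡ - + 16 × A * X + M * (B * Y) ≡ + 4 * T × B * X + A * Y ≡ + 4 * R
  conjugateProduct⁻ {M} {T} {R} {X} {Y} {A} {B} NW NE A≡ B≡ with isolate {A} A≡ | isolate {B} B≡
  ... | refl | refl =
      trans (norm4-product M T R X Y) (cong₂ _*_ NW NE)
    , trans (x-product M T R X Y) (trans (cong (T *_) NE) (*-comm T (+ 4)))
    , trans (y-product M T R X Y) (trans (cong (R *_) NE) (*-comm R (+ 4)))
    where
    norm4-product : ∀ M T R X Y → let A = T * X - M * (R * Y) ; B = R * X - T * Y in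
      A * A - M * (B * B) ≡ (T * T - M * (R * R)) * (X * X - M * (Y * Y))
    norm4-product = solve-∀
    x-product : ∀ M T R X Y → let A = T * X - M * (R * Y) ; B = R * X - T * Y in
      A * X + M * (B * Y) ≡ T * (X * X - M * (Y * Y))
    x-product = solve-∀
    y-product : ∀ M T R X Y → let A = T * X - M * (R * Y) ; B = R * X - T * Y in
      B * X + A * Y ≡ R * (X * X - M * (Y * Y))
    y-product = solve-∀

  conjugateProduct⁺ : ∀ {M T R X Y A B} → norm4 M T R ≡ + 4 → norm4 M X Y ≡ - + 4
    → A + T * X ≡ M * (R * Y) → B + R * X ≡ T * Y
    → norm4 M A B ≡ - + 16 × A * X + M * (B * Y) ≡ + 4 * T × B * X + A * Y ≡ + 4 * R
  conjugateProduct⁺ {M} {T} {R} {X} {Y} {A} {B} NW NE A≡ B≡ with isolate {A} A≡ | isolate {B} B≡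
  ... | refl | refl =
      trans (norm4-product M T R X Y) (cong₂ _*_ NW NE)
    , trans (x-product M T R X Y) (trans (cong (λ n → - T * n) NE) ([-x]*[-4]≡4x T))
    , trans (y-product M T R X Y) (trans (cong (λ n → - R * n) NE) ([-x]*[-4]≡4x R))
    where
    norm4-product : ∀ M T R X Y → let A = M * (R * Y) - T * X ; B = T * Y - R * X in
      A * A - M * (B * B) ≡ (T * T - M * (R * R)) * (X * X - M * (Y * Y))
    norm4-product = solve-∀
    x-product : ∀ M T R X Y → let A = M * (R * Y) - T * X ; B = T * Y - R * X in
      A * X + M * (B * Y) ≡ - T * (X * X - M * (Y * Y))
    x-product = solve-∀
    y-product : ∀ M T R X Y → let A = M * (R * Y) - T * X ; B = T * Y - R * X in
      B * X + A * Y ≡ - R * (X * X - M * (Y * Y))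
    y-product = solve-∀
    [-x]*[-4]≡4x : ∀ x → - x * - + 4 ≡ + 4 * x
    [-x]*[-4]≡4x = solve-∀

  halve-quotient : ∀ {m p q a b t r} → norm4 (+ m) (+ p + + p) (+ q + + q) ≡ - + 16
    → (+ p + + p) * + a + + m * ((+ q + + q) * + b) ≡ + 4 * + t
    → (+ q + + q) * + a + (+ p + + p) * + b ≡ + 4 * + r
    → Pell Sign.- m p q × Product m p q a b t r
  halve-quotient {m} {p} {q} {a} {b} {t} {r} N≡ x≡ y≡ =
      norm4≡⇒Pell Sign.- m (+ p) (+ q) (*-cancelˡ-≡ (+ 4) _ (- + 4) (trans (norm4-double (+ m) (+ p) (+ q)) N≡))
    , +-injective (begin
        + (p ℕ.* a ℕ.+ m ℕ.* (q ℕ.* b))  ≡⟨ cong₂ _+_ (pos-* p a) (pos-*-* m q b) ⟩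
        + p * + a + + m * (+ q * + b)    ≡⟨ *-cancelˡ-≡ (+ 2) _ _ (begin
          + 2 * (+ p * + a + + m * (+ q * + b))          ≡⟨ x-double (+ m) (+ p) (+ q) (+ a) (+ b) ⟩
          (+ p + + p) * + a + + m * ((+ q + + q) * + b)  ≡⟨ x≡ ⟩
          + 4 * + t                                      ≡⟨ four≡2*2 (+ t) ⟩
          + 2 * (+ 2 * + t)                              ∎) ⟩
        + 2 * + t                        ≡⟨ pos-* 2 t ⟨
        + (2 ℕ.* t)                      ∎)
    , +-injective (begin
        + (q ℕ.* a ℕ.+ p ℕ.* b)          ≡⟨ cong₂ _+_ (pos-* q a) (pos-* p b) ⟩
        + q * + a + + p * + b            ≡⟨ *-cancelˡ-≡ (+ 2) _ _ (begin
          + 2 * (+ q * + a + + p * + b)                  ≡⟨ y-double (+ p) (+ q) (+ a) (+ b) ⟩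
          (+ q + + q) * + a + (+ p + + p) * + b          ≡⟨ y≡ ⟩
          + 4 * + r                                      ≡⟨ four≡2*2 (+ r) ⟩
          + 2 * (+ 2 * + r)                              ∎) ⟩
        + 2 * + r                        ≡⟨ pos-* 2 r ⟨
        + (2 ℕ.* r)                      ∎)
    where
    open ≡-Reasoning
    norm4-double : ∀ M P Q → + 4 * (P * P - M * (Q * Q)) ≡ (P + P) * (P + P) - M * ((Q + Q) * (Q + Q))
    norm4-double = solve-∀
    x-double : ∀ M P Q X Y → + 2 * (P * X + M * (Q * Y)) ≡ (P + P) * X + M * ((Q + Q) * Y)
    x-double = solve-∀
    y-double : ∀ P Q X Y → + 2 * (Q * X + P * Y) ≡ (Q + Q) * X + (P + P) * Y
    y-double = solve-∀
    four≡2*2 : ∀ x → + 4 * x ≡ + 2 * (+ 2 * x)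
    four≡2*2 = solve-∀

  cast-sum : ∀ {U V W V' W'} → + V ≡ V' → + W ≡ W' → U ℕ.+ V ≡ W → + U + V' ≡ W'
  cast-sum refl refl U+V≡W = cong +_ U+V≡W

  -- For ε ≤ W of opposite norms, W/ε = ±W ε̄/4 has doubled coordinates ±(ta − mrb, ra − tb),
  -- which are positive and even: W/ε = (p + q√m)/2 is a unit > 1 of norm −1.
  quotient : ∀ {σ m t r a b} → 2 ℕ.≤ m → 1 ℕ.≤ r → 1 ℕ.≤ b
    → Pell σ m t r → Pell (Sign.opposite σ) m a b
    → Le (+ m) (+ a) (+ b) (+ t) (+ r)
    → ∃[ p ] ∃[ q ] 1 ℕ.≤ p × 1 ℕ.≤ q × Pell Sign.- m p q × Product m p q a b t r
  quotient {m = m} {t} {r} {a} {b} m≥2 _ b≥1 W@(pell⁻ _) E ε≤W =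
    let (x⁺ , y⁺) = conjugateProduct-positive⁻ m≥2 b≥1 W E (a≤t⊎b<r (Le-cases m ε≤W))
        (x-even , y-even) = conjugateProduct-even W E
        (p , p≥1 , 2p≡) = halve x⁺ x-even
        (q , q≥1 , 2q≡) = halve y⁺ y-even
        (N≡ , x≡ , y≡) = conjugateProduct⁻ {+ m} {+ t} {+ r} {+ a} {+ b} {+ (p ℕ.+ p)} {+ (q ℕ.+ q)}
          (Pell⇒norm4≡ W) (Pell⇒norm4≡ E)
          (cast-sum (pos-*-* m r b) (pos-* t a) 2p≡) (cast-sum (pos-* t b) (pos-* r a) 2q≡)
    in p , q , p≥1 , q≥1 , halve-quotient {m} {p} {q} {a} {b} {t} {r} N≡ x≡ y≡
    where
    a≤t⊎b<r : (a ℕ.≤ t × b ℕ.≤ r) ⊎ (a ℕ.< t × r ℕ.< b) ⊎ (t ℕ.< a × b ℕ.< r) → a ℕ.≤ t ⊎ b ℕ.< r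
    a≤t⊎b<r (inj₁ (a≤t , _))        = inj₁ a≤t
    a≤t⊎b<r (inj₂ (inj₁ (a<t , _))) = inj₁ (ℕₚ.<⇒≤ a<t)
    a≤t⊎b<r (inj₂ (inj₂ (_ , b<r))) = inj₂ b<r
  quotient {m = m} {t} {r} {a} {b} m≥2 r≥1 _ W@(pell⁺ _) E ε≤W =
    let (x⁺ , y⁺) = conjugateProduct-positive⁺ m≥2 r≥1 W E (b≤r⊎a<t (Le-cases m ε≤W))
        (x-even , y-even) = conjugateProduct-even W E
        (p , p≥1 , 2p≡) = halve x⁺ (map₂ (λ e → trans e (ℕₚ.+-comm (t ℕ.* a) _)) x-even)
        (q , q≥1 , 2q≡) = halve y⁺ (map₂ (λ e → trans e (ℕₚ.+-comm (r ℕ.* a) _)) y-even)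
        (N≡ , x≡ , y≡) = conjugateProduct⁺ {+ m} {+ t} {+ r} {+ a} {+ b} {+ (p ℕ.+ p)} {+ (q ℕ.+ q)}
          (Pell⇒norm4≡ W) (Pell⇒norm4≡ E)
          (cast-sum (pos-* t a) (pos-*-* m r b) 2p≡) (cast-sum (pos-* r a) (pos-* t b) 2q≡)
    in p , q , p≥1 , q≥1 , halve-quotient {m} {p} {q} {a} {b} {t} {r} N≡ x≡ y≡
    where
    b≤r⊎a<t : (a ℕ.≤ t × b ℕ.≤ r) ⊎ (a ℕ.< t × r ℕ.< b) ⊎ (t ℕ.< a × b ℕ.< r) → b ℕ.≤ r ⊎ a ℕ.< t
    b≤r⊎a<t (inj₁ (_ , b≤r))        = inj₁ b≤r
    b≤r⊎a<t (inj₂ (inj₁ (a<t , _))) = inj₂ a<t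
    b≤r⊎a<t (inj₂ (inj₂ (_ , b<r))) = inj₁ (ℕₚ.<⇒≤ b<r)

open PellSolutions
open IntegerEncoding
open import Data.Nat as ℕ using (ℕ; NonZero; z≤n; s≤s)
import Data.Nat.Properties as ℕₚ
open import Data.Integer.Base using (ℤ; +_; -_; _+_; _-_; _*_; _≤_; _◃_; +≤+)
open import Data.Integer.Properties using (pos-*; +-injective)
open import Relation.Nullary using (contradiction)

NoSmallerTrace : Sign → ℕ → ℕ → Set
NoSmallerTrace σ m t =
  ∀ (w : ℕ) → 1 ℕ.≤ w → w ℕ.< t
  → ∀ (M' : ℤ) (z : ℕ) → SFDecomp (+ w * + w - + 4 * (σ ◃ 1)) M' z → M' ≢ + m

IsLeast : Sign → ℕ → ℕ → ℕ → Set
IsLeast σ m t r = ∀ {w z} → 1 ℕ.≤ w → 1 ℕ.≤ z → Pell σ m w z → t ℕ.≤ w × r ℕ.≤ z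

positive-scaled-square≢0 : ∀ {m z} → 1 ℕ.≤ m → 1 ℕ.≤ z → + m * (+ z * + z) ≢ + 0
positive-scaled-square≢0 {ℕ.suc m} {ℕ.suc z} _ _ ()

Pell⁻⇒IsSquareOf : ∀ {m a b} → Pell Sign.- m a b → IsSquareOf (+ m) (+ (a ℕ.* a ℕ.+ 2)) (+ (a ℕ.* b)) (+ a) (+ b)
Pell⁻⇒IsSquareOf {m} {a} {b} E = (begin
    + 2 * + (a ℕ.* a ℕ.+ 2)       ≡⟨ pos-* 2 (a ℕ.* a ℕ.+ 2) ⟨
    + (2 ℕ.* (a ℕ.* a ℕ.+ 2))     ≡⟨ cong +_ (Pell⁻⇒2[a²+2]≡a²+mb² E) ⟩
    + (a ℕ.* a ℕ.+ m ℕ.* (b ℕ.* b)) ≡⟨ cong₂ _+_ (pos-* a a) (pos-*-* m b b) ⟩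
    + a * + a + + m * (+ b * + b) ∎)
  , pos-* a b
  where open ≡-Reasoning

module _ {m : ℕ} (m≥2 : 2 ℕ.≤ m) where

  private instance
    m-nonZero : NonZero m
    m-nonZero = ℕ.>-nonZero (ℕₚ.≤-trans (s≤s z≤n) m≥2)

  IsLeastUnit : ℕ → ℕ → Set
  IsLeastUnit a b = ∀ x y → IsUnit (+ m) x y → GtOne (+ m) x y → Le (+ m) (+ a) (+ b) x y

  IsLeastUnit⇒Le : ∀ {a b ρ w z} → IsLeastUnit a b → 1 ℕ.≤ w → 1 ℕ.≤ z → Pell ρ m w z
    → Le (+ m) (+ a) (+ b) (+ w) (+ z)
  IsLeastUnit⇒Le {w = w} {z} ε≤ w≥1 z≥1 E@(pell⁺ _) =
    ε≤ (+ w) (+ z) (inj₁ (Pell⇒norm4≡ E)) (positive⇒GtOne m≥2 w≥1 z≥1)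
  IsLeastUnit⇒Le {w = w} {z} ε≤ w≥1 z≥1 E@(pell⁻ _) =
    ε≤ (+ w) (+ z) (inj₂ (Pell⇒norm4≡ E)) (positive⇒GtOne m≥2 w≥1 z≥1)

  least-solution : ∀ σ {t r} → SquareFree (+ m) → Pell σ m t r
    → NoSmallerTrace σ m t
    → IsLeast σ m t r
  least-solution σ {t} sf W earlier {w} {z} w≥1 z≥1 E = t≤w , Pell-x≤⇒y≤ W E t≤w
    where
    t≤w : t ℕ.≤ w
    t≤w = ℕₚ.≮⇒≥ λ w<t → earlier w w≥1 w<t (+ m) z (inj₂ (w²-4σ≢0 , sf , z≥1 , Pell⇒decomposition E)) refl
      where
      w²-4σ≢0 : + w * + w - + 4 * (σ ◃ 1) ≢ + 0
      w²-4σ≢0 = subst (_≢ + 0) (sym (Pell⇒decomposition E))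
                  (positive-scaled-square≢0 (ℕₚ.≤-trans (s≤s z≤n) m≥2) z≥1)

  IsLeast⇒IsFundUnitOfNorm : ∀ σ {t r} → 1 ℕ.≤ t → 1 ℕ.≤ r → Pell σ m t r → IsLeast σ m t r
    → IsFundUnitOfNorm (+ m) (σ ◃ 1) (+ t) (+ r)
  IsLeast⇒IsFundUnitOfNorm σ {t} {r} t≥1 r≥1 W least =
    Pell⇒norm4≡ W , positive⇒GtOne m≥2 t≥1 r≥1 , λ x y N≡ x>1 → below (GtOne⇒positive σ x y N≡ x>1)
    where
    below : ∀ {x y} → PositiveSolution σ m x y → Le (+ m) (+ t) (+ r) x y
    below (w , z , refl , refl , w≥1 , z≥1 , E) = let (t≤w , r≤z) = least w≥1 z≥1 E in ≤×≤⇒Le m t≤w r≤z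

  least≡fundamental : ∀ {σ t r a b} → 1 ℕ.≤ t → 1 ℕ.≤ r → 1 ℕ.≤ a → 1 ℕ.≤ b
    → Pell σ m t r → IsLeast σ m t r → Pell σ m a b → IsLeastUnit a b → t ≡ a × r ≡ b
  least≡fundamental t≥1 r≥1 a≥1 b≥1 W least E ε≤ =
    let (t≤a , r≤b) = least a≥1 b≥1 E
        (a≤t , b≤r) = Pell-Le⇒≤×≤ E W (IsLeastUnit⇒Le ε≤ t≥1 r≥1 W)
    in ℕₚ.≤-antisym t≤a a≤t , ℕₚ.≤-antisym r≤b b≤r

  least⁻-fundamental⁺⇒⊥ : ∀ {t r a b} → 1 ℕ.≤ t → 1 ℕ.≤ r → 1 ℕ.≤ b
    → Pell Sign.- m t r → IsLeast Sign.- m t r → Pell Sign.+ m a b → IsLeastUnit a b → ⊥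
  least⁻-fundamental⁺⇒⊥ {t} {r} {a} {b} t≥1 r≥1 b≥1 W least E ε≤ =
    let (p , q , p≥1 , q≥1 , η , ηε≡W) = quotient m≥2 r≥1 b≥1 W E (IsLeastUnit⇒Le ε≤ t≥1 r≥1 W)
    in ℕₚ.<⇒≱ (factor-x<product-x {m} {p} {q} {a} {b} {t} {r} (Pell⁺-x≥3 m≥2 b≥1 E) t≥1 ηε≡W)
              (proj₁ (least p≥1 q≥1 η))

  least⁺≡fundamental⁻² : ∀ {t r a b} → 1 ℕ.≤ t → 1 ℕ.≤ r → 1 ℕ.≤ a → 1 ℕ.≤ b
    → Pell Sign.+ m t r → IsLeast Sign.+ m t r → Pell Sign.- m a b → IsLeastUnit a b
    → t ≡ a ℕ.* a ℕ.+ 2 × r ≡ a ℕ.* b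
  least⁺≡fundamental⁻² {a = a} t≥1 r≥1 a≥1 b≥1 W least E ε≤ =
    let (p , q , p≥1 , q≥1 , η , ηε≡W) = quotient m≥2 r≥1 b≥1 W E (IsLeastUnit⇒Le ε≤ t≥1 r≥1 W)
        (a≤p , b≤q) = Pell-Le⇒≤×≤ E η (IsLeastUnit⇒Le ε≤ p≥1 q≥1 η)
        (a²+2≤t , ab≤r) = square≤product E a≤p b≤q ηε≡W
        (t≤a²+2 , r≤ab) = least (ℕₚ.≤-trans (s≤s z≤n) (ℕₚ.m≤n+m 2 (a ℕ.* a))) (ℕₚ.*-mono-≤ a≥1 b≥1)
                                (Pell⁻-square E)
    in ℕₚ.≤-antisym t≤a²+2 a²+2≤t , ℕₚ.≤-antisym r≤ab ab≤r

  FundamentalUnitRelation : ℤ → ℕ → ℕ → ℤ → ℤ → Set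
  FundamentalUnitRelation s t r x y =
    ((s ≡ - + 1 ⊎ (s ≡ + 1 × norm4 (+ m) x y ≡ + 4)) → (+ t ≡ x × + r ≡ y))
    × ((s ≡ + 1 × norm4 (+ m) x y ≡ - + 4) → IsSquareOf (+ m) (+ t) (+ r) x y)

  least-vs-fundamental : ∀ {σ τ t r a b} → 1 ℕ.≤ t → 1 ℕ.≤ r → 1 ℕ.≤ a → 1 ℕ.≤ b
    → Pell σ m t r → IsLeast σ m t r → Pell τ m a b → IsLeastUnit a b
    → FundamentalUnitRelation (σ ◃ 1) t r (+ a) (+ b)
  least-vs-fundamental t≥1 r≥1 a≥1 b≥1 W@(pell⁺ _) least E@(pell⁺ _) ε≤ =
      (λ _ → let (t≡a , r≡b) = least≡fundamental t≥1 r≥1 a≥1 b≥1 W least E ε≤ in cong +_ t≡a , cong +_ r≡b)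
    , (λ (_ , N≡-4) → contradiction (trans (sym (Pell⇒norm4≡ E)) N≡-4) λ ())
  least-vs-fundamental {a = a} {b} t≥1 r≥1 a≥1 b≥1 W@(pell⁺ _) least E@(pell⁻ _) ε≤ =
      (λ { (inj₁ ()) ; (inj₂ (_ , N≡4)) → contradiction (trans (sym (Pell⇒norm4≡ E)) N≡4) λ () })
    , (λ _ → let (t≡ , r≡) = least⁺≡fundamental⁻² t≥1 r≥1 a≥1 b≥1 W least E ε≤
             in subst₂ (λ t r → IsSquareOf (+ m) (+ t) (+ r) (+ a) (+ b)) (sym t≡) (sym r≡) (Pell⁻⇒IsSquareOf E))
  least-vs-fundamental t≥1 r≥1 a≥1 b≥1 W@(pell⁻ _) least E@(pell⁺ _) ε≤ =
    ⊥-elim (least⁻-fundamental⁺⇒⊥ t≥1 r≥1 b≥1 W least E ε≤)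
  least-vs-fundamental t≥1 r≥1 a≥1 b≥1 W@(pell⁻ _) least E@(pell⁻ _) ε≤ =
      (λ _ → let (t≡a , r≡b) = least≡fundamental t≥1 r≥1 a≥1 b≥1 W least E ε≤ in cong +_ t≡a , cong +_ r≡b)
    , (λ { (() , _) })

  fundamentalUnitOfNorm : ∀ σ {t r} → 1 ℕ.≤ t → SFDecomp (+ t * + t - + 4 * (σ ◃ 1)) (+ m) r
    → NoSmallerTrace σ m t
    → IsFundUnitOfNorm (+ m) (σ ◃ 1) (+ t) (+ r)
      × (∀ x y → IsFundUnit (+ m) x y → FundamentalUnitRelation (σ ◃ 1) t r x y)
  fundamentalUnitOfNorm σ t≥1 (inj₁ (_ , m≡0)) _ = contradiction (+-injective m≡0) (ℕ.≢-nonZero⁻¹ m)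
  fundamentalUnitOfNorm σ {t} {r} t≥1 (inj₂ (_ , sf , r≥1 , decomposition)) earlier =
    IsLeast⇒IsFundUnitOfNorm σ t≥1 r≥1 W least , compare
    where
    W : Pell σ m t r
    W = decomposition⇒Pell σ decomposition
    least : IsLeast σ m t r
    least = least-solution σ sf W earlier
    relation : ∀ {τ x y} → PositiveSolution τ m x y
      → (∀ x' y' → IsUnit (+ m) x' y' → GtOne (+ m) x' y' → Le (+ m) x y x' y')
      → FundamentalUnitRelation (σ ◃ 1) t r x y
    relation (a , b , refl , refl , a≥1 , b≥1 , E) ε≤ = least-vs-fundamental t≥1 r≥1 a≥1 b≥1 W least E ε≤
    compare : ∀ x y → IsFundUnit (+ m) x y → FundamentalUnitRelation (σ ◃ 1) t r x y
    compare x y (inj₁ N≡ , x>1 , ε≤) = relation (GtOne⇒positive Sign.+ x y N≡ x>1) ε≤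
    compare x y (inj₂ N≡ , x>1 , ε≤) = relation (GtOne⇒positive Sign.- x y N≡ x>1) ε≤

theorem4p2 : (s : ℤ) → (s ≡ + 1 ⊎ s ≡ - + 1)
    → (t₀ : ℕ) → 1 ℕ.≤ t₀ → (M : ℤ) → (r : ℕ)
    → SFDecomp (+ t₀ * + t₀ - + 4 * s) M r
    → + 2 ≤ M
    → (∀ (t : ℕ) → 1 ℕ.≤ t → t ℕ.< t₀ → ∀ (M' : ℤ) (r' : ℕ)
         → SFDecomp (+ t * + t - + 4 * s) M' r' → M' ≢ M)
    → IsFundUnitOfNorm M s (+ t₀) (+ r)
      × (∀ (x y : ℤ) → IsFundUnit M x y
         → ((s ≡ - + 1 ⊎ (s ≡ + 1 × norm4 M x y ≡ + 4)) → (+ t₀ ≡ x × + r ≡ y))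
           × ((s ≡ + 1 × norm4 M x y ≡ - + 4) → IsSquareOf M (+ t₀) (+ r) x y))
theorem4p2 _ (inj₁ refl) _ t₀≥1 (+ _) _ decomposition (+≤+ m≥2) earlier =
  fundamentalUnitOfNorm m≥2 Sign.+ t₀≥1 decomposition earlier
theorem4p2 _ (inj₂ refl) _ t₀≥1 (+ _) _ decomposition (+≤+ m≥2) earlier =
  fundamentalUnitOfNorm m≥2 Sign.- t₀≥1 decomposition earlier
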